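{- Let $G=(V,E)$ be a graph. For all $k\in\mathbb{N}$ and all $c>k_1(G)$, the instance $(G,c,k)$ is a Yes-instance of \textsc{Multi-STC}.
   Context: A $c$-labeling of an undirected graph $G=(V,E)$ is a partition $L=(S^1_L,\dots,S^c_L,W_L)$ of $E$; edges in $S^i_L$ are strong (color $i$), edges in $W_L$ are weak. $L$ is an STC-labeling if there is no pair of edges $\{u,v\},\{v,w\}$ in the same $S^i_L$ with $\{u,w\}\notin E$. \textsc{Multi-STC}: given $G$ and $c,k\in\mathbb{N}$, decide whether there is a $c$-labeling which is an STC-labeling with $|W_L|\le k$. $k_1(G)$ is the minimum number of weak edges in an STC-labeling of $G$ with one strong color ($c=1$). -}

module Defs where

open import Data.Nat using (ℕ; _<_; _≤_; _+_)
open import Data.Fin using (Fin) renaming (_<_ to _<ᶠ_)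
open import Data.List using (List; length; lookup; allFin; map)
open import Data.Nat.ListAction using (sum)
open import Data.List.Relation.Unary.All using (All)
open import Data.List.Relation.Unary.Unique.Propositional using (Unique)
open import Data.Maybe using (Maybe; just; nothing)
open import Data.Product using (_×_; _,_; proj₁; proj₂; Σ; ∃; ∃-syntax)
open import Data.Sum using (_⊎_)
open import Relation.Binary.PropositionalEquality using (_≡_; _≢_)
open import Relation.Nullary using (¬_)

-- A finite simple undirected graph on vertex set Fin n.
-- Each edge {u,v} is stored exactly once as an ordered pair (u , v) with u < v
-- (so no loops, no multi-edges).
record Graph : Set where
  field
    n       : ℕ
    edges   : List (Fin n × Fin n)
    ordered : All (λ e → proj₁ e <ᶠ proj₂ e) edges
    unique  : Unique edges
open Graph public

Edge : Graph → Set
Edge G = Fin (length (edges G))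

EdgeIs : (G : Graph) → Edge G → Fin (n G) → Fin (n G) → Set
EdgeIs G e u v = lookup (edges G) e ≡ (u , v) ⊎ lookup (edges G) e ≡ (v , u)

Adj : (G : Graph) → Fin (n G) → Fin (n G) → Set
Adj G u v = ∃[ e ] EdgeIs G e u v

-- A c-labeling: every edge gets either a strong color (just i, i : Fin c)
-- or is weak (nothing). This is exactly a partition (S¹,…,Sᶜ,W) of E.
Labeling : Graph → ℕ → Set
Labeling G c = Edge G → Maybe (Fin c)

isWeak : ∀ {c} → Maybe (Fin c) → ℕ
isWeak nothing  = 1
isWeak (just _) = 0

weakCount : ∀ {G c} → Labeling G c → ℕ
weakCount {G} L = sum (map (λ e → isWeak (L e)) (allFin (length (edges G))))

Violation : (G : Graph) (c : ℕ) → Labeling G c → Set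
Violation G c L =
  Σ (Edge G) λ e₁ → Σ (Edge G) λ e₂ → Σ (Fin c) λ i →
  Σ (Fin (n G)) λ u → Σ (Fin (n G)) λ v → Σ (Fin (n G)) λ w →
    e₁ ≢ e₂ × EdgeIs G e₁ u v × EdgeIs G e₂ v w ×
    L e₁ ≡ just i × L e₂ ≡ just i × ¬ Adj G u w

IsSTC : (G : Graph) (c : ℕ) → Labeling G c → Set
IsSTC G c L = ¬ Violation G c L

MultiSTC : Graph → ℕ → ℕ → Set
MultiSTC G c k = Σ (Labeling G c) λ L → IsSTC G c L × weakCount {G} L ≤ k

IsK1 : Graph → ℕ → Set
IsK1 G m =
  (Σ (Labeling G 1) λ L → IsSTC G 1 L × weakCount {G} L ≡ m) ×
  (∀ (L : Labeling G 1) → IsSTC G 1 L → m ≤ weakCount {G} L)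

-- A 1-colored STC-labeling with k₁ weak edges is turned into one without weak
-- edges by giving each weak edge its own fresh color: a singleton color class
-- can never contain a violating pair.  This uses 1 + k₁ ≤ c colors, and
-- unused colors are harmless.
module Submission where

open import Defs
open import Data.Nat using (ℕ; suc; _+_; _<_; _≤_; z≤n; s≤s)
open import Data.Nat.Properties using (+-monoʳ-<; +-cancelˡ-≡; ≤-trans)
open import Data.Fin using (Fin; fromℕ<; inject≤; splitAt; _↑ˡ_; _↑ʳ_)
  renaming (zero to fzero; suc to fsuc)
open import Data.Fin.Properties using (↑ˡ-injective; ↑ʳ-injective; splitAt-↑ˡ; splitAt-↑ʳ;
  fromℕ<-injective; inject≤-injective)
open import Data.List using (List; []; _∷_; map; tabulate; allFin; length)
open import Data.List.Properties using (map-tabulate; map-cong)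
open import Data.Nat.ListAction using (sum)
open import Data.Maybe using (Maybe; just; nothing)
import Data.Maybe as Maybe
open import Data.Maybe.Properties using (just-injective)
open import Data.Product using (_×_; _,_; ∃-syntax)
open import Data.Empty using (⊥-elim)
open import Data.Sum using (_⊎_; inj₁; inj₂)
open import Function using (_∘_; id)
open import Function.Definitions using (Injective)
open import Relation.Binary.PropositionalEquality using (_≡_; _≢_; refl; sym; trans; cong; subst)

sum-map-zero : {A : Set} (xs : List A) → sum (map (λ _ → 0) xs) ≡ 0
sum-map-zero []       = refl
sum-map-zero (x ∷ xs) = sum-map-zero xs

isWeak-map : ∀ {c c′} (σ : Fin c → Fin c′) (x : Maybe (Fin c)) → isWeak (Maybe.map σ x) ≡ isWeak x
isWeak-map σ (just _) = refl
isWeak-map σ nothing  = refl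

↑ˡ≢↑ʳ : ∀ {m n} (i : Fin m) (j : Fin n) → i ↑ˡ n ≢ m ↑ʳ j
↑ˡ≢↑ʳ {m} {n} i j eq with trans (sym (splitAt-↑ˡ m i n)) (trans (cong (splitAt m) eq) (splitAt-↑ʳ m n j))
... | ()

module _ {c : ℕ} where

  weakTotal : ∀ {m} → (Fin m → Maybe (Fin c)) → ℕ
  weakTotal f = sum (tabulate (isWeak ∘ f))

  weakRank : ∀ {m} → (Fin m → Maybe (Fin c)) → Fin m → ℕ
  weakRank f fzero    = 0
  weakRank f (fsuc i) = isWeak (f fzero) + weakRank (f ∘ fsuc) i

  weakRank<weakTotal : ∀ {m} (f : Fin m → Maybe (Fin c)) i → f i ≡ nothing → weakRank f i < weakTotal f
  weakRank<weakTotal f fzero    fi≡nothing rewrite fi≡nothing = s≤s z≤n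
  weakRank<weakTotal f (fsuc i) fi≡nothing =
    +-monoʳ-< (isWeak (f fzero)) (weakRank<weakTotal (f ∘ fsuc) i fi≡nothing)

  weakRank-injective : ∀ {m} (f : Fin m → Maybe (Fin c)) {i j} → f i ≡ nothing → f j ≡ nothing →
                       weakRank f i ≡ weakRank f j → i ≡ j
  weakRank-injective f {fzero}  {fzero}  _  _  _ = refl
  weakRank-injective f {fzero}  {fsuc j} fi fj r rewrite fi with r
  ... | ()
  weakRank-injective f {fsuc i} {fzero}  fi fj r rewrite fj with r
  ... | ()
  weakRank-injective f {fsuc i} {fsuc j} fi fj r =
    cong fsuc (weakRank-injective (f ∘ fsuc) fi fj (+-cancelˡ-≡ (isWeak (f fzero)) _ _ r))

module Saturation {c m : ℕ} (f : Fin m → Maybe (Fin c)) where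

  color : (i : Fin m) (x : Maybe (Fin c)) → f i ≡ x → Fin (c + weakTotal f)
  color i (just a) _          = a ↑ˡ weakTotal f
  color i nothing  fi≡nothing = c ↑ʳ fromℕ< (weakRank<weakTotal f i fi≡nothing)

  saturate : Fin m → Fin (c + weakTotal f)
  saturate i = color i (f i) refl

  color-collision : ∀ {i j} (x y : Maybe (Fin c)) (fi : f i ≡ x) (fj : f j ≡ y) →
                    color i x fi ≡ color j y fj → i ≡ j ⊎ ∃[ a ] f i ≡ just a × f j ≡ just a
  color-collision (just a) (just b) fi fj eq with ↑ˡ-injective (weakTotal f) a b eq
  ... | refl = inj₂ (a , fi , fj)
  color-collision (just a) nothing  fi fj eq = ⊥-elim (↑ˡ≢↑ʳ a _ eq)
  color-collision nothing  (just b) fi fj eq = ⊥-elim (↑ˡ≢↑ʳ b _ (sym eq))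
  color-collision nothing  nothing  fi fj eq =
    inj₁ (weakRank-injective f fi fj (fromℕ<-injective _ _ _ _ (↑ʳ-injective c _ _ eq)))

  saturate-collision : ∀ {i j} → saturate i ≡ saturate j → i ≡ j ⊎ ∃[ a ] f i ≡ just a × f j ≡ just a
  saturate-collision = color-collision (f _) (f _) refl refl

module _ (G : Graph) where

  RefinesStrong : ∀ {c c′} → Labeling G c′ → Labeling G c → Set
  RefinesStrong L′ L = ∀ {e₁ e₂ i} → e₁ ≢ e₂ → L′ e₁ ≡ just i → L′ e₂ ≡ just i →
                       ∃[ j ] L e₁ ≡ just j × L e₂ ≡ just j

  IsSTC-refine : ∀ {c c′} {L : Labeling G c} {L′ : Labeling G c′} →
                 RefinesStrong L′ L → IsSTC G c L → IsSTC G c′ L′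
  IsSTC-refine refines stc (e₁ , e₂ , _ , u , v , w , e₁≢e₂ , e₁uv , e₂vw , L′e₁ , L′e₂ , ¬uw)
    with refines e₁≢e₂ L′e₁ L′e₂
  ... | j , Le₁ , Le₂ = stc (e₁ , e₂ , j , u , v , w , e₁≢e₂ , e₁uv , e₂vw , Le₁ , Le₂ , ¬uw)

  weakCount≡weakTotal : ∀ {c} (L : Labeling G c) → weakCount {G} L ≡ weakTotal L
  weakCount≡weakTotal L = cong sum (map-tabulate id (isWeak ∘ L))

  MultiSTC-saturate : ∀ {c} {L : Labeling G c} → IsSTC G c L → MultiSTC G (c + weakCount {G} L) 0
  MultiSTC-saturate {c} {L} stc rewrite weakCount≡weakTotal L =
    L′ , IsSTC-refine refines stc , subst (_≤ 0) (sym (sum-map-zero (allFin (length (edges G))))) z≤n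
    where
    open Saturation L
    L′ : Labeling G (c + weakTotal L)
    L′ = just ∘ saturate
    refines : RefinesStrong L′ L
    refines e₁≢e₂ refl L′e₂ with saturate-collision (just-injective (sym L′e₂))
    ... | inj₁ e₁≡e₂ = ⊥-elim (e₁≢e₂ e₁≡e₂)
    ... | inj₂ shared = shared

  MultiSTC-recolor : ∀ {c c′ k} (σ : Fin c → Fin c′) → Injective _≡_ _≡_ σ → MultiSTC G c k → MultiSTC G c′ k
  MultiSTC-recolor σ σ-injective (L , stc , weak≤k) =
    Maybe.map σ ∘ L , IsSTC-refine (λ _ → shared (L _) (L _)) stc ,
    subst (_≤ _) (sym (cong sum (map-cong (isWeak-map σ ∘ L) (allFin _)))) weak≤k
    where
    shared : ∀ {i} x y → Maybe.map σ x ≡ just i → Maybe.map σ y ≡ just i → ∃[ j ] x ≡ just j × y ≡ just j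
    shared (just a) (just b) σa≡i σb≡i with σ-injective (just-injective (trans σa≡i (sym σb≡i)))
    ... | refl = a , refl , refl

  MultiSTC-mono-colors : ∀ {c c′ k} → c ≤ c′ → MultiSTC G c k → MultiSTC G c′ k
  MultiSTC-mono-colors c≤c′ = MultiSTC-recolor (λ i → inject≤ i c≤c′) (inject≤-injective c≤c′ c≤c′ _ _)

  MultiSTC-mono-budget : ∀ {c k k′} → k ≤ k′ → MultiSTC G c k → MultiSTC G c k′
  MultiSTC-mono-budget k≤k′ (L , stc , weak≤k) = L , stc , ≤-trans weak≤k k≤k′

lemma4 : (G : Graph) (k₁ : ℕ) → IsK1 G k₁ →
    (k c : ℕ) → k₁ < c → MultiSTC G c k
lemma4 G k₁ ((L , stc , weak≡k₁) , _) k c k₁<c =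
  MultiSTC-mono-budget G z≤n
    (MultiSTC-mono-colors G (subst (λ w → suc w ≤ c) (sym weak≡k₁) k₁<c)
      (MultiSTC-saturate G stc))
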